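{- Let $u,t>0$, let $\mathfrak{S} = \Omega_u A_t K$ be a standard Siegel set in $\mathbf{GL}_n(\mathbb{R})$, and let $\gamma \in \mathfrak{S}.\mathfrak{S}^{ -1} \cap \mathbf{GL}_n(\mathbb{Q})$. Partition $\{1,\dots,n\}$ into the segments of $\gamma$. If $i > j$ and $i$ and $j$ lie in the same segment, then there exists a sequence of leading entries $(i_1,j_1),\dots,(i_s,j_s)$ of $\gamma$ such that \[ i \leq i_1, \quad j_p \leq i_{p+1} \text{ for every } p \in \{1,\dots,s-1\}, \quad \text{and} \quad j_s \leq j. \]
   Context: Standard Siegel sets: $K = \mathbf{O}_n(\mathbb{R})$; $A_t$ is the set of real diagonal matrices $\alpha$ with positive diagonal entries $\alpha_1,\dots,\alpha_n$ satisfying $\alpha_j/\alpha_{j+1} \geq t$ for all $j$; $\Omega_u$ is the set of real upper triangular matrices $\nu$ with $\nu_{ii}=1$ for all $i$ and $|\nu_{ij}| \leq u$ for $i<j$. A standard Siegel set is $\Omega_u A_t K$ for some $u,t>0$. Also $\mathfrak{S}.\mathfrak{S}^{ -1} \cap \mathbf{GL}_n(\mathbb{Q}) = \{\gamma \in \mathbf{GL}_n(\mathbb{Q}) : \gamma\mathfrak{S} \cap \mathfrak{S} \neq \emptyset\}$. Segments: for a partition of $\{1,\dots,n\}$ into subintervals (sets of consecutive integers) $I_1 < \dots < I_r$, a matrix $\gamma$ is block upper triangular with respect to it if $\gamma_{ij} = 0$ whenever $i \in I_a$, $j \in I_b$ with $a > b$. The segments of $\gamma$ are the subintervals of the unique partition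 of $\{1,\dots,n\}$ into subintervals such that $\gamma$ is block upper triangular with respect to it but not with respect to any finer partition into subintervals. Leading entry: a pair $(i,j)$ such that $\gamma_{ij}$ is the leftmost non-zero entry in the $i$-th row of $\gamma$. -}

module Defs where

open import Level using (0ℓ)
open import Data.Nat as ℕ using (ℕ; zero; suc)
open import Data.Fin using (Fin; zero; suc; toℕ; inject₁)
open import Data.Product using (Σ; ∃; ∃-syntax; _×_; _,_)
open import Data.Sum using (_⊎_)
open import Data.Bool using (Bool; true; false)
open import Data.Rational as ℚ using (ℚ; 0ℚ; 1ℚ)
open import Relation.Binary.PropositionalEquality using (_≡_; _≢_)
open import Relation.Nullary using (¬_)
open import Algebra.Structures using (IsCommutativeRing)
open import Relation.Binary.Structures using (IsStrictTotalOrder)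

-- The real numbers, axiomatised as a complete ordered field
-- (any two such are isomorphic, so quantifying over them = talking about ℝ).

record RealField : Set₁ where
  infixl 6 _+_
  infixl 7 _*_
  infix 4 _<_ _≤_
  field
    Carrier : Set
    0r 1r   : Carrier
    _+_ _*_ : Carrier → Carrier → Carrier
    -_      : Carrier → Carrier
    _<_     : Carrier → Carrier → Set
    isCommutativeRing : IsCommutativeRing _≡_ _+_ _*_ -_ 0r 1r
    0≢1     : 0r ≢ 1r
    inverse : ∀ x → x ≢ 0r → ∃[ y ] (x * y ≡ 1r)
    isStrictTotalOrder : IsStrictTotalOrder _≡_ _<_
    +-mono-< : ∀ {x y} z → x < y → x + z < y + z
    *-pos    : ∀ {x y} → 0r < x → 0r < y → 0r < x * y

  _≤_ : Carrier → Carrier → Set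
  x ≤ y = (x < y) ⊎ (x ≡ y)

  field
    complete : (P : Carrier → Set) → ∃[ x ] P x → ∃[ b ] (∀ x → P x → x ≤ b) →
               ∃[ s ] ((∀ x → P x → x ≤ s) × (∀ b → (∀ x → P x → x ≤ b) → s ≤ b))
    ι      : ℚ → Carrier
    ι-0    : ι 0ℚ ≡ 0r
    ι-1    : ι 1ℚ ≡ 1r
    ι-+    : ∀ p q → ι (p ℚ.+ q) ≡ ι p + ι q
    ι-*    : ∀ p q → ι (p ℚ.* q) ≡ ι p * ι q

-- Square matrices as functions (0-based indices)

Mat : Set → ℕ → Set
Mat A n = Fin n → Fin n → A

sumFin : {A : Set} → A → (A → A → A) → (n : ℕ) → (Fin n → A) → A
sumFin z _⊕_ zero    f = z
sumFin z _⊕_ (suc n) f = f zero ⊕ sumFin z _⊕_ n (λ k → f (suc k))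

_·ℚ_ : {n : ℕ} → Mat ℚ n → Mat ℚ n → Mat ℚ n
_·ℚ_ {n} a b i j = sumFin 0ℚ ℚ._+_ n (λ k → a i k ℚ.* b k j)

idℚ : {n : ℕ} → Mat ℚ n
idℚ i j with toℕ i ℕ.≟ toℕ j
... | Relation.Nullary.yes _ = 1ℚ
... | Relation.Nullary.no _  = 0ℚ

InGLℚ : (n : ℕ) → Mat ℚ n → Set
InGLℚ n γ = ∃[ δ ] ((∀ i j → (γ ·ℚ δ) i j ≡ idℚ i j) × (∀ i j → (δ ·ℚ γ) i j ≡ idℚ i j))

module Siegel (R : RealField) where
  open RealField R

  _·_ : {n : ℕ} → Mat Carrier n → Mat Carrier n → Mat Carrier n
  _·_ {n} a b i j = sumFin 0r _+_ n (λ k → a i k * b k j)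

  idR : {n : ℕ} → Mat Carrier n
  idR i j with toℕ i ℕ.≟ toℕ j
  ... | Relation.Nullary.yes _ = 1r
  ... | Relation.Nullary.no _  = 0r

  transpose : {n : ℕ} → Mat Carrier n → Mat Carrier n
  transpose a i j = a j i

  InK : (n : ℕ) → Mat Carrier n → Set
  InK n k = ∀ i j → (k · transpose k) i j ≡ idR i j

  -- A_t : positive diagonal with α_j / α_{j+1} ≥ t, i.e. t·α_{j+1} ≤ α_j
  InA : (n : ℕ) → Carrier → Mat Carrier n → Set
  InA n t α = (∀ i j → toℕ i ≢ toℕ j → α i j ≡ 0r)
            × (∀ i → 0r < α i i)
            × (∀ (i j : Fin n) → suc (toℕ i) ≡ toℕ j → t * α j j ≤ α i i)

  InΩ : (n : ℕ) → Carrier → Mat Carrier n → Set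
  InΩ n u ν = (∀ i j → toℕ j ℕ.< toℕ i → ν i j ≡ 0r)
            × (∀ i → ν i i ≡ 1r)
            × (∀ i j → toℕ i ℕ.< toℕ j → (- u ≤ ν i j) × (ν i j ≤ u))

  InSiegel : (n : ℕ) → Carrier → Carrier → Mat Carrier n → Set
  InSiegel n u t g = ∃[ ν ] ∃[ α ] ∃[ k ]
    (InΩ n u ν × InA n t α × InK n k × (∀ i j → g i j ≡ ((ν · α) · k) i j))

  ιMat : {n : ℕ} → Mat ℚ n → Mat Carrier n
  ιMat γ i j = ι (γ i j)

  -- γ ∈ 𝔖.𝔖⁻¹ ∩ GL_n(ℚ)  ⇔  γ ∈ GL_n(ℚ) and γ𝔖 ∩ 𝔖 ≠ ∅
  InSS⁻¹ : (n : ℕ) → Carrier → Carrier → Mat ℚ n → Set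
  InSS⁻¹ n u t γ = InGLℚ n γ × ∃[ g ] (InSiegel n u t g × InSiegel n u t (ιMat γ · g))

-- Partitions of {0,…,n-1} into subintervals, encoded by cut sets:
-- C c ≡ true (for toℕ c ≥ 1) means a new block starts at index c.
-- (The value at index 0 is irrelevant.)

Cuts : ℕ → Set
Cuts n = Fin n → Bool

LaterBlock : {n : ℕ} → Cuts n → Fin n → Fin n → Set
LaterBlock C a b = ∃[ c ] (C c ≡ true × toℕ b ℕ.< toℕ c × toℕ c ℕ.≤ toℕ a)

SameBlock : {n : ℕ} → Cuts n → Fin n → Fin n → Set
SameBlock C i j = ∀ c → toℕ j ℕ.< toℕ c → toℕ c ℕ.≤ toℕ i → C c ≡ false

BlockUpperTriangular : {n : ℕ} → Mat ℚ n → Cuts n → Set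
BlockUpperTriangular γ C = ∀ a b → LaterBlock C a b → γ a b ≡ 0ℚ

StrictlyFiner : {n : ℕ} → Cuts n → Cuts n → Set
StrictlyFiner C' C = (∀ c → C c ≡ true → C' c ≡ true)
                   × ∃[ c ] (1 ℕ.≤ toℕ c × C' c ≡ true × C c ≡ false)

IsSegmentPartition : {n : ℕ} → Mat ℚ n → Cuts n → Set
IsSegmentPartition γ C = BlockUpperTriangular γ C
                       × (∀ C' → StrictlyFiner C' C → ¬ BlockUpperTriangular γ C')

LeadingEntry : {n : ℕ} → Mat ℚ n → Fin n → Fin n → Set
LeadingEntry γ i j = γ i j ≢ 0ℚ × (∀ k → toℕ k ℕ.< toℕ j → γ i k ≡ 0ℚ)

-- a sequence (i_1,j_1),…,(i_s,j_s), s = suc s', of leading entries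
-- with i ≤ i_1, j_p ≤ i_{p+1}, j_s ≤ j
LeadingChain : {n : ℕ} → Mat ℚ n → Fin n → Fin n → Set
LeadingChain {n} γ i j =
  Σ ℕ λ s' → Σ (Fin (suc s') → Fin n × Fin n) λ seq → (
    (∀ (p : Fin (suc s')) → LeadingEntry γ (Data.Product.proj₁ (seq p)) (Data.Product.proj₂ (seq p)))
    × toℕ i ℕ.≤ toℕ (Data.Product.proj₁ (seq zero))
    × (∀ (p : Fin s') → toℕ (Data.Product.proj₂ (seq (inject₁ p))) ℕ.≤ toℕ (Data.Product.proj₁ (seq (suc p))))
    × toℕ (Data.Product.proj₂ (seq (Data.Fin.fromℕ s'))) ℕ.≤ toℕ j)

-- For each y with j ≤ y < i, cutting the segment between y and y + 1 would give a finer
-- block upper triangular partition, so some nonzero entry γ a b has b ≤ y < a, and the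
-- leading entry (a , c) of row a has c ≤ b ≤ y. Chaining these crossings from y = j up
-- to y = i - 1 yields the required sequence of leading entries.
module Submission where

open import Defs
open import Data.Nat using (ℕ)
open import Data.Fin using (Fin; toℕ)
open import Data.Rational using (ℚ)

open import Data.Bool using (false; _∨_)
open import Data.Bool.Properties using (∨-zeroʳ)
open import Data.Empty using (⊥-elim)
open import Data.Fin as Fin using (zero; suc; fromℕ<)
open import Data.Fin.Properties
  using (toℕ<n; toℕ-injective; toℕ-inject; toℕ-fromℕ<; any?; ¬∀⟶∃¬-smallest)
open import Data.Nat as ℕ using (suc; _≤_; _<_; z≤n; s≤s; s≤s⁻¹)
open import Data.Nat.Properties using (≤-refl; ≤-trans; <⇒≤; ≮⇒≥)
open import Data.Product using (∃-syntax; _×_; _,_; proj₁; proj₂)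
open import Data.Rational using (0ℚ)
open import Data.Rational.Properties using (_≟_)
open import Relation.Binary.PropositionalEquality using (_≡_; _≢_; refl; sym; trans; cong; subst)
open import Relation.Nullary using (yes; no; does; ¬?)
open import Relation.Nullary.Decidable using (_×-dec_; dec-true; decidable-stable)

private
  variable
    n : ℕ
    γ : Mat ℚ n
    C : Cuts n
    a c i j r : Fin n

leadingEntry-≤ : (γ : Mat ℚ n) (a b : Fin n) → γ a b ≢ 0ℚ →
                 ∃[ c ] (toℕ c ≤ toℕ b × LeadingEntry γ a c)
leadingEntry-≤ {n} γ a b γab≢0
  with c , γac≢0 , zero-before ← ¬∀⟶∃¬-smallest n (λ k → γ a k ≡ 0ℚ) (λ k → γ a k ≟ 0ℚ)
                                                  (λ row-zero → γab≢0 (row-zero b))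
  = c , ≮⇒≥ (λ b<c → γab≢0 (zero-below b b<c)) , γac≢0 , zero-below
  where
    zero-below : ∀ k → toℕ k < toℕ c → γ a k ≡ 0ℚ
    zero-below k k<c =
      subst (λ k′ → γ a k′ ≡ 0ℚ)
            (toℕ-injective (trans (toℕ-inject (fromℕ< k<c)) (toℕ-fromℕ< k<c)))
            (zero-before (fromℕ< k<c))

leadingChain-single : LeadingEntry γ a c → toℕ c ≤ toℕ j → LeadingChain γ a j
leadingChain-single {a = a} {c = c} lead c≤j =
  0 , (λ _ → a , c) , (λ _ → lead) , ≤-refl , (λ ()) , c≤j

leadingChain-cons : LeadingEntry γ a c → toℕ c ≤ toℕ r → LeadingChain γ r j → LeadingChain γ a j
leadingChain-cons {γ = γ} {a = a} {c = c} lead c≤r (s , seq , leads , r≤ , links , last≤j) =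
  suc s , seq′ , leads′ , ≤-refl , links′ , last≤j
  where
    seq′ : Fin (suc (suc s)) → Fin _ × Fin _
    seq′ zero    = a , c
    seq′ (suc p) = seq p

    leads′ : ∀ p → LeadingEntry γ (proj₁ (seq′ p)) (proj₂ (seq′ p))
    leads′ zero    = lead
    leads′ (suc p) = leads p

    links′ : ∀ (p : Fin (suc s)) → toℕ (proj₂ (seq′ (Fin.inject₁ p))) ≤ toℕ (proj₁ (seq′ (suc p)))
    links′ zero    = ≤-trans c≤r r≤
    links′ (suc p) = links p

leadingChain-mono : toℕ i ≤ toℕ a → LeadingChain γ a j → LeadingChain γ i j
leadingChain-mono i≤a (s , seq , leads , a≤ , rest) = s , seq , leads , ≤-trans i≤a a≤ , rest

insertCut : Cuts n → Fin n → Cuts n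
insertCut C c k = does (k Fin.≟ c) ∨ C k

insertCut-strictlyFiner : 1 ≤ toℕ c → C c ≡ false → StrictlyFiner (insertCut C c) C
insertCut-strictlyFiner {c = c} {C = C} 1≤c uncut =
  (λ k cut → trans (cong (does (k Fin.≟ c) ∨_) cut) (∨-zeroʳ _)) ,
  c , 1≤c , cong (_∨ C c) (dec-true (c Fin.≟ c) refl) , uncut

insertCut-blockUpper : BlockUpperTriangular γ C →
                       (∀ a b → toℕ b < toℕ c → toℕ c ≤ toℕ a → γ a b ≡ 0ℚ) →
                       BlockUpperTriangular γ (insertCut C c)
insertCut-blockUpper {c = c} upper zero-across a b (c′ , cut , b<c′ , c′≤a) with c′ Fin.≟ c
... | yes refl = zero-across a b b<c′ c′≤a
... | no _     = upper a b (c′ , cut , b<c′ , c′≤a)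

segment-crossing : IsSegmentPartition γ C → 1 ≤ toℕ c → C c ≡ false →
                   ∃[ a ] ∃[ b ] (toℕ b < toℕ c × toℕ c ≤ toℕ a × γ a b ≢ 0ℚ)
segment-crossing {γ = γ} {C = C} {c = c} (upper , coarsest) 1≤c uncut
  with any? (λ a → any? (λ b → (toℕ b ℕ.<? toℕ c) ×-dec (toℕ c ℕ.≤? toℕ a) ×-dec ¬? (γ a b ≟ 0ℚ)))
... | yes crossing   = crossing
... | no no-crossing =
  ⊥-elim (coarsest (insertCut C c) (insertCut-strictlyFiner 1≤c uncut)
                   (insertCut-blockUpper upper zero-across))
  where
    zero-across : ∀ a b → toℕ b < toℕ c → toℕ c ≤ toℕ a → γ a b ≡ 0ℚ
    zero-across a b b<c c≤a =
      decidable-stable (γ a b ≟ 0ℚ) (λ γab≢0 → no-crossing (a , b , b<c , c≤a , γab≢0))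

module _ {γ : Mat ℚ n} {C : Cuts n} (segments : IsSegmentPartition γ C)
         {i j : Fin n} (same : SameBlock C i j) where

  leadingEntry-across : ∀ y → toℕ j ≤ y → y < toℕ i →
                        ∃[ a ] (y < toℕ a × ∃[ c ] (toℕ c ≤ y × LeadingEntry γ a c))
  leadingEntry-across y j≤y y<i = across (fromℕ< y+1<n) (toℕ-fromℕ< y+1<n)
    where
      y+1<n : suc y < n
      y+1<n = ≤-trans (s≤s y<i) (toℕ<n i)

      across : (k : Fin n) → toℕ k ≡ suc y →
               ∃[ a ] (y < toℕ a × ∃[ c ] (toℕ c ≤ y × LeadingEntry γ a c))
      across k k≡y+1 =
        let j<k = subst (toℕ j <_) (sym k≡y+1) (s≤s j≤y)
            k≤i = subst (_≤ toℕ i) (sym k≡y+1) y<i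
            a , b , b<k , k≤a , γab≢0 = segment-crossing segments (≤-trans (s≤s z≤n) j<k)
                                                          (same k j<k k≤i)
            c , c≤b , lead = leadingEntry-≤ γ a b γab≢0
        in a , subst (_≤ toℕ a) k≡y+1 k≤a
         , c , ≤-trans c≤b (s≤s⁻¹ (subst (toℕ b <_) k≡y+1 b<k)) , lead

  leadingChain-above : ∀ k → toℕ j < k → k ≤ toℕ i → ∃[ r ] (k ≤ toℕ r × LeadingChain γ r j)
  leadingChain-above (suc y) (s≤s j≤y) y<i
    with a , y<a , c , c≤y , lead ← leadingEntry-across y j≤y y<i
    with toℕ j ℕ.<? y
  ... | yes j<y = let r , y≤r , chain = leadingChain-above y j<y (<⇒≤ y<i)
                  in a , y<a , leadingChain-cons lead (≤-trans c≤y y≤r) chain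
  ... | no j≮y  = a , y<a , leadingChain-single lead (≤-trans c≤y (≮⇒≥ j≮y))

  leadingChain : toℕ j < toℕ i → LeadingChain γ i j
  leadingChain j<i with r , i≤r , chain ← leadingChain-above (toℕ i) j<i ≤-refl =
    leadingChain-mono {γ = γ} i≤r chain

lemma3p1 : (R : RealField) (n : ℕ) (u t : RealField.Carrier R) →
    RealField._<_ R (RealField.0r R) u → RealField._<_ R (RealField.0r R) t →
    (γ : Mat ℚ n) → Siegel.InSS⁻¹ R n u t γ →
    (C : Cuts n) → IsSegmentPartition γ C →
    (i j : Fin n) → toℕ j Data.Nat.< toℕ i → SameBlock C i j →
    LeadingChain γ i j
lemma3p1 _ _ _ _ _ _ _ _ _ segments _ _ j<i same = leadingChain segments same j<i
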